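{- Let $\Pi$ be a partition of $[n]$. (i) If $\delta_n\notin S_\Pi$, then $\mathrm{Comp}_{n+1}(S_\Pi) = S_{\Pi'}$. (ii) If $\delta_n\in S_\Pi$, then $\mathrm{Comp}_{n+1}(S_\Pi) = S_{\Pi'}\cup \delta_{n+1}S_{\Pi'} = \langle S_{\Pi'},\delta_{n+1}\rangle$; moreover $\Pi' = \delta_{n+1}(\Pi')$.
   Context: $S_n$ is the symmetric group on $[n]=\{1,\dots,n\}$ (composition right to left); $\delta_n$ is $i\mapsto n+1-i$. For a partition $\Pi$ of $[n]$, $S_\Pi=\{\pi\in S_n: \pi(B)=B \text{ for every block } B\in\Pi\}$, and $\delta_n(\Pi)=\{\delta_n(B):B\in\Pi\}$. Let $\widehat{\Pi}$ be the coarsest partition of $[n]$ into intervals that refines $\Pi$; let $[1]_{\widehat\Pi}$ and $[n]_{\widehat\Pi}$ be its blocks containing $1$ and $n$. Define partitions of $[n+1]$: $\widehat\Pi^{1}=\{B+1 : B\in\widehat\Pi,\,1\notin B\}\cup\{([1]_{\widehat\Pi}+1)\cup\{1\}\}$ (where $B+1=\{x+1:x\in B\}$) and $\widehat\Pi^{n+1}=\{B: B\in\widehat\Pi,\, n\notin B\}\cup\{[n]_{\widehat\Pi}\cup\{n+1\}\}$. Then $\Pi'$ is the coarsest common refinement of $\widehat\Pi^1$ and $\widehat\Pi^{n+1}$ (a partition of $[n+1]$). A permutation $\pi\in S_m$ involves $\tau\in S_n$ ($n\le m$) if there are indices $i_1<\dots<i_n$ with $\pi(i_j)<\pi(i_k)$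 iff $\tau(j)<\tau(k)$ for all $j,k$; such $\tau$ is an $n$-pattern of $\pi$. For $S\subseteq S_n$, $\mathrm{Comp}_m(S)$ is the set of all $\tau\in S_m$ all of whose $n$-patterns belong to $S$. -}

module Defs where

open import Data.Nat using (ℕ; zero; suc)
open import Data.Fin using (Fin; zero; suc; inject₁; fromℕ; _<_; _≤_)
open import Data.Fin.Permutation using (Permutation′; _⟨$⟩ʳ_; reverse)
open import Data.Product using (Σ; ∃; _×_; _,_)
open import Relation.Binary.PropositionalEquality using (_≡_)

-- S_n is Permutation′ n (bijections of Fin n, Fin n ≅ [n] via i ↦ i+1).
-- A "set of permutations" is a predicate on Permutation′ n.
PermSet : ℕ → Set₁
PermSet n = Permutation′ n → Set

-- δ_n : i ↦ n+1-i  (on Fin n: i ↦ n-1-i), the stdlib's `reverse`.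
δ : (n : ℕ) → Permutation′ n
δ n = reverse

_≐_ : ∀ {n} → PermSet n → PermSet n → Set
A ≐ B = ∀ σ → (A σ → B σ) × (B σ → A σ)

_∪_ : ∀ {n} → PermSet n → PermSet n → PermSet n
(A ∪ B) σ = Data.Sum._⊎_ (A σ) (B σ)
  where import Data.Sum

_·_ : ∀ {n} → Permutation′ n → PermSet n → PermSet n
(g · A) τ = Σ (Permutation′ _) λ σ → A σ × (∀ i → τ ⟨$⟩ʳ i ≡ g ⟨$⟩ʳ (σ ⟨$⟩ʳ i))

-- ⟨ A , g ⟩ : the subgroup of S_n generated by A ∪ {g}
-- (smallest set containing A and g, the identity, closed under
-- composition and inverses; permutations are compared pointwise).
data Generated {n : ℕ} (A : PermSet n) (g : Permutation′ n) : PermSet n where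
  gen-set : ∀ {σ} → A σ → Generated A g σ
  gen-elt : Generated A g g
  gen-id  : ∀ {σ} → (∀ i → σ ⟨$⟩ʳ i ≡ i) → Generated A g σ
  gen-∘   : ∀ {σ ρ τ} → Generated A g σ → Generated A g ρ →
            (∀ i → τ ⟨$⟩ʳ i ≡ σ ⟨$⟩ʳ (ρ ⟨$⟩ʳ i)) → Generated A g τ
  gen-inv : ∀ {σ τ} → Generated A g σ →
            (∀ i → τ ⟨$⟩ʳ (σ ⟨$⟩ʳ i) ≡ i) → Generated A g τ

Involves : ∀ {m n} → Permutation′ m → Permutation′ n → Set
Involves {m} {n} π τ =
  Σ (Fin n → Fin m) λ ι →
    (∀ j k → j < k → ι j < ι k) ×
    (∀ j k → ((π ⟨$⟩ʳ ι j) < (π ⟨$⟩ʳ ι k) → (τ ⟨$⟩ʳ j) < (τ ⟨$⟩ʳ k))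
           × ((τ ⟨$⟩ʳ j) < (τ ⟨$⟩ʳ k) → (π ⟨$⟩ʳ ι j) < (π ⟨$⟩ʳ ι k)))

Comp : ∀ {n} (m : ℕ) → PermSet n → PermSet m
Comp {n} m S π = ∀ (τ : Permutation′ n) → Involves π τ → S τ

-- Set partitions of [n]
-- A partition of [n] is given by a block-labelling  P : Fin n → ℕ ;
-- its blocks are the nonempty fibres, i.e. x, y lie in the same block
-- iff P x ≡ P y.  Two labellings describing the same blocks are the same
-- partition.

Partition : ℕ → Set
Partition n = Fin n → ℕ

SameBlock : ∀ {n} → Partition n → Fin n → Fin n → Set
SameBlock P x y = P x ≡ P y

_≋_ : ∀ {n} → Partition n → Partition n → Set
P ≋ Q = ∀ x y → (SameBlock P x y → SameBlock Q x y) × (SameBlock Q x y → SameBlock P x y)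

Refines : ∀ {n} → Partition n → Partition n → Set
Refines P Q = ∀ x y → SameBlock P x y → SameBlock Q x y

IsIntervalPartition : ∀ {n} → Partition n → Set
IsIntervalPartition P = ∀ x y z → x ≤ y → y ≤ z → SameBlock P x z → SameBlock P x y

IsCoarsestIntervalRefinement : ∀ {n} → Partition n → Partition n → Set
IsCoarsestIntervalRefinement {n} P H =
  IsIntervalPartition H × Refines H P ×
  (∀ (K : Partition n) → IsIntervalPartition K → Refines K P → Refines K H)

IsCoarsestCommonRefinement : ∀ {n} → Partition n → Partition n → Partition n → Set
IsCoarsestCommonRefinement {n} P Q C =
  Refines C P × Refines C Q ×
  (∀ (K : Partition n) → Refines K P → Refines K Q → Refines K C)

S[_] : ∀ {n} → Partition n → PermSet n
S[ P ] π = (∀ x → SameBlock P (π ⟨$⟩ʳ x) x)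
         × (∀ y → Σ _ λ x → (π ⟨$⟩ʳ x ≡ y) × SameBlock P x y)

δ-part : ∀ {n} → Partition n → Partition n
δ-part {n} P x = P (δ n ⟨$⟩ʳ x)

-- For H a partition of [n] with n ≥ 1 (written n = suc k):
-- H^1 on [n+1]: blocks B+1 (1 ∉ B) and ([1]_H + 1) ∪ {1};
-- i.e. position 1 joins the block of 2, and i+1 gets the block of i.
hat¹ : ∀ {k} → Partition (suc k) → Partition (suc (suc k))
hat¹ H zero    = H zero
hat¹ H (suc i) = H i

-- H^{n+1} on [n+1]: blocks B (n ∉ B) and [n]_H ∪ {n+1}.
-- clamp: Fin (n+1) → Fin n, identity on [n], and n+1 ↦ n
clamp : ∀ {k} → Fin (suc (suc k)) → Fin (suc k)
clamp {zero}  _       = zero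
clamp {suc k} zero    = zero
clamp {suc k} (suc i) = suc (clamp i)

hatⁿ⁺¹ : ∀ {k} → Partition (suc k) → Partition (suc (suc k))
hatⁿ⁺¹ H i = H (clamp i)

-- An n-pattern of τ ∈ S_{n+1} is τ with one entry deleted, so τ ∈ Comp_{n+1}(S_Π) iff every
-- deletion of τ lies in S_Π.  Call c a cut if Π(c) ≠ Π(c+1) (positions counted from 0); these are
-- the boundaries of Π̂, and each becomes a singleton block {c+1} of Π′ separating the positions ≤ c
-- from those > c+1.  So S_Π′ consists of the permutations fixing every such c+1 and preserving both
-- sides, and every deletion of such a permutation keeps the blocks of Π̂, hence those of Π.
-- Conversely, let all deletions of τ lie in S_Π.  Deleting an entry p ≤ c or r > c+1 moves the
-- entry at c+1 to position c resp. c+1, on the two sides of a cut, so its value must differ in the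
-- two patterns: τ(c+1) lies between τ(p) and τ(r).  Comparing τ(first) with τ(last), this forces
-- τ or δτ to respect all cuts, i.e. to lie in S_Π′.  In the second case deleting the first entry
-- of τ and of δτ gives ρ and δρ in S_Π, whence δ ∈ S_Π.  Finally, if δ ∈ S_Π then Π̂ and hence Π′
-- are δ-symmetric, so conjugation by δ preserves S_Π′ and S_Π′ ∪ δS_Π′ is the group generated by
-- S_Π′ and δ.

module Submission where

open import Data.Empty using (⊥; ⊥-elim)
open import Data.Fin as Fin using (Fin; zero; suc; toℕ; fromℕ; fromℕ<; punchIn; punchOut; opposite)
open import Data.Fin.Permutation as Perm using (Permutation′; _⟨$⟩ʳ_; _⟨$⟩ˡ_; inverseˡ; inverseʳ; remove; _∘ₚ_)
open import Data.Fin.Properties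
  using ( toℕ-injective; toℕ<n; toℕ-fromℕ; toℕ-fromℕ<; fromℕ<-toℕ; toℕ-inject₁; injective⇒≤
        ; punchOut-cong; punchIn-punchOut; punchOut-punchIn; punchInᵢ≢i; punchIn-mono-≤; punchIn-injective
        ; punchOut-mono-≤; punchOut-cancel-≤; punchOut-injective; opposite-prop; opposite-involutive )
open import Data.Nat as ℕ using (ℕ; zero; suc; pred; _+_; _∸_; z≤n; s≤s)
import Data.Nat.Properties as ℕₚ
open import Data.Product using (Σ; _×_; _,_; proj₁; proj₂)
open import Data.Sum using (_⊎_; inj₁; inj₂; [_,_]′; map; map₂)
open import Function using (_∘_; id)
open import Relation.Binary.Definitions using (tri<; tri≈; tri>)
open import Relation.Binary.PropositionalEquality
open import Relation.Nullary using (¬_; yes; no)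
open import Relation.Nullary.Decidable using (_×-dec_)
open import Defs

m≢n⇒m<n⊎n<m : ∀ {m n} → m ≢ n → m ℕ.< n ⊎ n ℕ.< m
m≢n⇒m<n⊎n<m {m} {n} m≢n with ℕₚ.<-cmp m n
... | tri< m<n _ _ = inj₁ m<n
... | tri≈ _ m≡n _ = ⊥-elim (m≢n m≡n)
... | tri> _ _ n<m = inj₂ n<m

<-transfer : ∀ {a b c d} → (a ℕ.≤ b → c ℕ.≤ d) → (c ≡ d → a ≡ b) → a ℕ.< b → c ℕ.< d
<-transfer mono inj a<b = ℕₚ.≤∧≢⇒< (mono (ℕₚ.<⇒≤ a<b)) (λ c≡d → ℕₚ.<-irrefl (inj c≡d) a<b)

toℕ-≢ : ∀ {m} {x y : Fin m} → x ≢ y → toℕ x ≢ toℕ y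
toℕ-≢ x≢y = x≢y ∘ toℕ-injective

toℕ-punchOut-< : ∀ {m} {i j : Fin (suc m)} (i≢j : i ≢ j) → toℕ j ℕ.< toℕ i → toℕ (punchOut i≢j) ≡ toℕ j
toℕ-punchOut-< {m} {zero} i≢j ()
toℕ-punchOut-< {zero} {suc ()} i≢j _
toℕ-punchOut-< {suc m} {suc i} {zero} i≢j _ = refl
toℕ-punchOut-< {suc m} {suc i} {suc j} i≢j (s≤s j<i) = cong suc (toℕ-punchOut-< (i≢j ∘ cong suc) j<i)

suc-toℕ-punchOut-> : ∀ {m} {i j : Fin (suc m)} (i≢j : i ≢ j) → toℕ i ℕ.< toℕ j → suc (toℕ (punchOut i≢j)) ≡ toℕ j
suc-toℕ-punchOut-> {m} {zero} {zero} i≢j ()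
suc-toℕ-punchOut-> {m} {zero} {suc j} i≢j _ = refl
suc-toℕ-punchOut-> {zero} {suc ()} i≢j _
suc-toℕ-punchOut-> {suc m} {suc i} {zero} i≢j ()
suc-toℕ-punchOut-> {suc m} {suc i} {suc j} i≢j (s≤s i<j) = cong suc (suc-toℕ-punchOut-> (i≢j ∘ cong suc) i<j)

toℕ-punchOut-≤ : ∀ {m} {i j : Fin (suc m)} (i≢j : i ≢ j) → toℕ (punchOut i≢j) ℕ.≤ toℕ j
toℕ-punchOut-≤ i≢j with m≢n⇒m<n⊎n<m (toℕ-≢ (i≢j ∘ sym))
... | inj₁ j<i = ℕₚ.≤-reflexive (toℕ-punchOut-< i≢j j<i)
... | inj₂ i<j = subst (toℕ (punchOut i≢j) ℕ.≤_) (suc-toℕ-punchOut-> i≢j i<j) (ℕₚ.n≤1+n _)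

toℕ-≤-suc-punchOut : ∀ {m} {i j : Fin (suc m)} (i≢j : i ≢ j) → toℕ j ℕ.≤ suc (toℕ (punchOut i≢j))
toℕ-≤-suc-punchOut i≢j with m≢n⇒m<n⊎n<m (toℕ-≢ (i≢j ∘ sym))
... | inj₁ j<i = subst (ℕ._≤ suc (toℕ (punchOut i≢j))) (toℕ-punchOut-< i≢j j<i) (ℕₚ.n≤1+n _)
... | inj₂ i<j = ℕₚ.≤-reflexive (sym (suc-toℕ-punchOut-> i≢j i<j))

opposite-reverses-< : ∀ {m} {x y : Fin m} → toℕ x ℕ.< toℕ y → toℕ (opposite y) ℕ.< toℕ (opposite x)
opposite-reverses-< {m} {x} {y} x<y =
  subst₂ ℕ._<_ (sym (opposite-prop y)) (sym (opposite-prop x)) (ℕₚ.∸-monoʳ-< (s≤s x<y) (toℕ<n y))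

opposite-reverses-≤ : ∀ {m} {x y : Fin m} → toℕ x ℕ.≤ toℕ y → toℕ (opposite y) ℕ.≤ toℕ (opposite x)
opposite-reverses-≤ {m} {x} {y} x≤y =
  subst₂ ℕ._≤_ (sym (opposite-prop y)) (sym (opposite-prop x)) (ℕₚ.∸-monoʳ-≤ m (s≤s x≤y))

opposite-reflects-< : ∀ {m} {x y : Fin m} → toℕ (opposite x) ℕ.< toℕ (opposite y) → toℕ y ℕ.< toℕ x
opposite-reflects-< {x = x} {y} lt =
  subst₂ (λ u v → toℕ u ℕ.< toℕ v) (opposite-involutive y) (opposite-involutive x) (opposite-reverses-< lt)

opposite-injective : ∀ {m} {x y : Fin m} → opposite x ≡ opposite y → x ≡ y
opposite-injective {x = x} {y} e = trans (sym (opposite-involutive x)) (trans (cong opposite e) (opposite-involutive y))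

punchOut-opposite : ∀ {m} {i j : Fin (suc m)} (i≢j : i ≢ j) (i≢j′ : opposite i ≢ opposite j) →
                    punchOut i≢j′ ≡ opposite (punchOut i≢j)
punchOut-opposite {m} {i} {j} i≢j i≢j′ with m≢n⇒m<n⊎n<m (toℕ-≢ (i≢j ∘ sym))
... | inj₁ j<i = toℕ-injective (ℕₚ.suc-injective (begin
      suc (toℕ (punchOut i≢j′))          ≡⟨ suc-toℕ-punchOut-> i≢j′ (opposite-reverses-< j<i) ⟩
      toℕ (opposite j)                   ≡⟨ opposite-prop j ⟩
      m ∸ toℕ j                          ≡⟨ ℕₚ.+-∸-assoc 1 (ℕₚ.<-≤-trans j<i (ℕ.s≤s⁻¹ (toℕ<n i))) ⟩
      suc (m ∸ suc (toℕ j))              ≡⟨ cong (λ z → suc (m ∸ suc z)) (sym (toℕ-punchOut-< i≢j j<i)) ⟩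
      suc (m ∸ suc (toℕ (punchOut i≢j))) ≡⟨ cong suc (sym (opposite-prop (punchOut i≢j))) ⟩
      suc (toℕ (opposite (punchOut i≢j))) ∎))
  where open ≡-Reasoning
... | inj₂ i<j = toℕ-injective (begin
      toℕ (punchOut i≢j′)                ≡⟨ toℕ-punchOut-< i≢j′ (opposite-reverses-< i<j) ⟩
      toℕ (opposite j)                   ≡⟨ opposite-prop j ⟩
      m ∸ toℕ j                          ≡⟨ cong (m ∸_) (sym (suc-toℕ-punchOut-> i≢j i<j)) ⟩
      m ∸ suc (toℕ (punchOut i≢j))       ≡⟨ sym (opposite-prop (punchOut i≢j)) ⟩
      toℕ (opposite (punchOut i≢j))      ∎)
  where open ≡-Reasoning

StrictlyIncreasing : ∀ {a b} → (Fin a → Fin b) → Set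
StrictlyIncreasing f = ∀ j k → toℕ j ℕ.< toℕ k → toℕ (f j) ℕ.< toℕ (f k)

increasing-≥-shift : ∀ {a b} (f : Fin (suc a) → Fin b) → StrictlyIncreasing f →
                     ∀ j → toℕ (f zero) + toℕ j ℕ.≤ toℕ (f j)
increasing-≥-shift f inc zero = ℕₚ.≤-reflexive (ℕₚ.+-identityʳ _)
increasing-≥-shift {suc a} f inc (suc j) =
  subst (ℕ._≤ toℕ (f (suc j))) (sym (ℕₚ.+-suc (toℕ (f zero)) (toℕ j))) (ℕₚ.≤-<-trans ih step)
  where
  inc-init : StrictlyIncreasing (f ∘ Fin.inject₁)
  inc-init x y x<y = inc (Fin.inject₁ x) (Fin.inject₁ y) (subst₂ ℕ._<_ (sym (toℕ-inject₁ x)) (sym (toℕ-inject₁ y)) x<y)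
  ih : toℕ (f zero) + toℕ j ℕ.≤ toℕ (f (Fin.inject₁ j))
  ih = increasing-≥-shift (f ∘ Fin.inject₁) inc-init j
  step : toℕ (f (Fin.inject₁ j)) ℕ.< toℕ (f (suc j))
  step = inc (Fin.inject₁ j) (suc j) (ℕₚ.≤-reflexive (cong suc (toℕ-inject₁ j)))

increasing-room : ∀ {a b} (f : Fin a → Fin b) → StrictlyIncreasing f → ∀ j → toℕ (f j) + a ℕ.≤ toℕ j + b
increasing-room {suc zero} {b} f inc zero = subst (ℕ._≤ b) (ℕₚ.+-comm 1 (toℕ (f zero))) (toℕ<n (f zero))
increasing-room {suc (suc a)} {b} f inc zero =
  let ih   = increasing-room (f ∘ suc) (λ x y x<y → inc (suc x) (suc y) (s≤s x<y)) zero
      step = inc zero (suc zero) (s≤s z≤n)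
  in subst (ℕ._≤ b) (sym (ℕₚ.+-suc (toℕ (f zero)) (suc a))) (ℕₚ.≤-trans (ℕₚ.+-monoˡ-≤ (suc a) step) ih)
increasing-room {suc a} {b} f inc (suc j) =
  let ih = increasing-room (f ∘ suc) (λ x y x<y → inc (suc x) (suc y) (s≤s x<y)) j
  in subst (ℕ._≤ suc (toℕ j + b)) (sym (ℕₚ.+-suc (toℕ (f (suc j))) a)) (s≤s ih)

increasing-endo-≗id : ∀ {m} (h : Fin m → Fin m) → StrictlyIncreasing h → ∀ j → h j ≡ j
increasing-endo-≗id {suc m} h inc j = toℕ-injective (ℕₚ.≤-antisym
  (ℕₚ.+-cancelʳ-≤ (suc m) _ _ (increasing-room h inc j))
  (ℕₚ.≤-trans (ℕₚ.m≤n+m _ _) (increasing-≥-shift h inc j)))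

increasing⇒punchIn : ∀ {m} (ι : Fin m → Fin (suc m)) → StrictlyIncreasing ι →
                     Σ (Fin (suc m)) λ p → ∀ j → ι j ≡ punchIn p j
increasing⇒punchIn {zero} ι inc = zero , λ ()
increasing⇒punchIn {suc m} ι inc with ι zero in ι0≡
... | zero = suc p , ι≗
  where
  0<ι-suc : ∀ j → 0 ℕ.< toℕ (ι (suc j))
  0<ι-suc j = subst (ℕ._< toℕ (ι (suc j))) (cong toℕ ι0≡) (inc zero (suc j) (s≤s z≤n))
  0≢ι-suc : ∀ j → zero ≢ ι (suc j)
  0≢ι-suc j e = ℕₚ.<-irrefl (cong toℕ e) (0<ι-suc j)
  ι′ : Fin m → Fin (suc m)
  ι′ j = punchOut (0≢ι-suc j)
  suc-ι′ : ∀ j → suc (toℕ (ι′ j)) ≡ toℕ (ι (suc j))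
  suc-ι′ j = suc-toℕ-punchOut-> (0≢ι-suc j) (0<ι-suc j)
  inc′ : StrictlyIncreasing ι′
  inc′ a b a<b = ℕ.s<s⁻¹ (subst₂ ℕ._<_ (sym (suc-ι′ a)) (sym (suc-ι′ b)) (inc (suc a) (suc b) (s≤s a<b)))
  p = proj₁ (increasing⇒punchIn ι′ inc′)
  ι≗ : ∀ j → ι j ≡ punchIn (suc p) j
  ι≗ zero = ι0≡
  ι≗ (suc j) = toℕ-injective (trans (sym (suc-ι′ j)) (cong (suc ∘ toℕ) (proj₂ (increasing⇒punchIn ι′ inc′) j)))
... | suc x = zero , λ j → toℕ-injective (ℕₚ.≤-antisym (upper j) (lower j))
  where
  upper : ∀ j → toℕ (ι j) ℕ.≤ suc (toℕ j)
  upper j = ℕₚ.+-cancelʳ-≤ (suc m) _ _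
    (subst (toℕ (ι j) + suc m ℕ.≤_) (ℕₚ.+-suc (toℕ j) (suc m)) (increasing-room ι inc j))
  lower : ∀ j → suc (toℕ j) ℕ.≤ toℕ (ι j)
  lower j = ℕₚ.≤-trans (s≤s (ℕₚ.m≤n+m (toℕ j) (toℕ x)))
    (subst (λ z → toℕ z + toℕ j ℕ.≤ toℕ (ι j)) ι0≡ (increasing-≥-shift ι inc j))

⟨$⟩ʳ-injective : ∀ {m} (σ : Permutation′ m) {x y} → σ ⟨$⟩ʳ x ≡ σ ⟨$⟩ʳ y → x ≡ y
⟨$⟩ʳ-injective σ e = trans (sym (inverseˡ σ)) (trans (cong (σ ⟨$⟩ˡ_) e) (inverseˡ σ))

⟨$⟩ʳ-≢ : ∀ {m} (σ : Permutation′ m) {x y} → x ≢ y → σ ⟨$⟩ʳ x ≢ σ ⟨$⟩ʳ y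
⟨$⟩ʳ-≢ σ x≢y = x≢y ∘ ⟨$⟩ʳ-injective σ

order-isomorphic⇒≗ : ∀ {m} (σ ρ : Permutation′ m) →
  (∀ j k → toℕ (σ ⟨$⟩ʳ j) ℕ.< toℕ (σ ⟨$⟩ʳ k) → toℕ (ρ ⟨$⟩ʳ j) ℕ.< toℕ (ρ ⟨$⟩ʳ k)) →
  ∀ j → σ ⟨$⟩ʳ j ≡ ρ ⟨$⟩ʳ j
order-isomorphic⇒≗ σ ρ same-order j =
  trans (sym (increasing-endo-≗id ρσ⁻¹ inc (σ ⟨$⟩ʳ j))) (cong (ρ ⟨$⟩ʳ_) (inverseˡ σ))
  where
  ρσ⁻¹ = λ a → ρ ⟨$⟩ʳ (σ ⟨$⟩ˡ a)
  inc : StrictlyIncreasing ρσ⁻¹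
  inc a b a<b = same-order _ _ (subst₂ (λ u v → toℕ u ℕ.< toℕ v) (sym (inverseʳ σ)) (sym (inverseʳ σ)) a<b)

injection-into-prefix⇒≤ : ∀ {a b} (h : Fin a → Fin b) → (∀ {x y} → h x ≡ h y → x ≡ y) →
  ∀ x y → x ℕ.≤ a → (∀ p → toℕ p ℕ.< x → toℕ (h p) ℕ.< y) → x ℕ.≤ y
injection-into-prefix⇒≤ h h-inj x y x≤a below = injective⇒≤ {f = g} g-inj
  where
  emb : Fin x → Fin _
  emb i = fromℕ< (ℕₚ.<-≤-trans (toℕ<n i) x≤a)
  emb<x : ∀ i → toℕ (emb i) ℕ.< x
  emb<x i = subst (ℕ._< x) (sym (toℕ-fromℕ< _)) (toℕ<n i)
  g : Fin x → Fin y
  g i = fromℕ< (below (emb i) (emb<x i))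
  g-inj : ∀ {i j} → g i ≡ g j → i ≡ j
  g-inj {i} {j} e = toℕ-injective (trans (sym (toℕ-fromℕ< _)) (trans (cong toℕ (h-inj (toℕ-injective
    (trans (sym (toℕ-fromℕ< _)) (trans (cong toℕ e) (toℕ-fromℕ< _)))))) (toℕ-fromℕ< _)))

punchIn-strictlyIncreasing : ∀ {m} (p : Fin (suc m)) → StrictlyIncreasing (punchIn p)
punchIn-strictlyIncreasing p j k =
  <-transfer (punchIn-mono-≤ p j k) (λ e → cong toℕ (punchIn-injective p j k (toℕ-injective e)))

module _ {m} (τ : Permutation′ (suc m)) (p : Fin (suc m)) where

  remove-reflects-< : ∀ j k → toℕ (remove p τ ⟨$⟩ʳ j) ℕ.< toℕ (remove p τ ⟨$⟩ʳ k) →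
                      toℕ (τ ⟨$⟩ʳ punchIn p j) ℕ.< toℕ (τ ⟨$⟩ʳ punchIn p k)
  remove-reflects-< j k = <-transfer
    (punchOut-cancel-≤ {i = τ ⟨$⟩ʳ p} {j = τ ⟨$⟩ʳ punchIn p j} {k = τ ⟨$⟩ʳ punchIn p k} _ _)
    (λ e → cong toℕ (punchOut-cong (τ ⟨$⟩ʳ p) (toℕ-injective e)))

  remove-preserves-< : ∀ j k → toℕ (τ ⟨$⟩ʳ punchIn p j) ℕ.< toℕ (τ ⟨$⟩ʳ punchIn p k) →
                       toℕ (remove p τ ⟨$⟩ʳ j) ℕ.< toℕ (remove p τ ⟨$⟩ʳ k)
  remove-preserves-< j k = <-transfer
    (punchOut-mono-≤ {i = τ ⟨$⟩ʳ p} {j = τ ⟨$⟩ʳ punchIn p j} {k = τ ⟨$⟩ʳ punchIn p k} _ _)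
    (λ e → cong toℕ (punchOut-injective {i = τ ⟨$⟩ʳ p} {j = τ ⟨$⟩ʳ punchIn p j} {k = τ ⟨$⟩ʳ punchIn p k} _ _
                       (toℕ-injective e)))

S[]-intro : ∀ {m} (P : Partition m) (σ : Permutation′ m) → (∀ x → P (σ ⟨$⟩ʳ x) ≡ P x) → S[ P ] σ
S[]-intro P σ σ-preserves = σ-preserves , λ y → σ ⟨$⟩ˡ y , inverseʳ σ , trans (sym (σ-preserves _)) (cong P (inverseʳ σ))

DeletionsPreserve : ∀ {m} → Partition m → Permutation′ (suc m) → Set
DeletionsPreserve L τ = ∀ p j → L (remove p τ ⟨$⟩ʳ j) ≡ L j

Comp⇒deletionsPreserve : ∀ {m} (L : Partition m) (τ : Permutation′ (suc m)) →
                         Comp (suc m) S[ L ] τ → DeletionsPreserve L τ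
Comp⇒deletionsPreserve L τ τ∈Comp p = proj₁ (τ∈Comp (remove p τ) involved)
  where
  involved : Involves τ (remove p τ)
  involved = punchIn p , punchIn-strictlyIncreasing p ,
             λ j k → remove-preserves-< τ p j k , remove-reflects-< τ p j k

deletionsPreserve⇒Comp : ∀ {m} (L : Partition m) (τ : Permutation′ (suc m)) →
                         DeletionsPreserve L τ → Comp (suc m) S[ L ] τ
deletionsPreserve⇒Comp L τ deletions σ (ι , ι-inc , same-order) =
  S[]-intro L σ (λ j → trans (cong L (σ≗deletion j)) (deletions p j))
  where
  p = proj₁ (increasing⇒punchIn ι ι-inc)
  ι≗ = proj₂ (increasing⇒punchIn ι ι-inc)
  σ≗deletion = order-isomorphic⇒≗ σ (remove p τ) λ j k σj<σk →
    remove-preserves-< τ p j k (subst₂ (λ u v → toℕ (τ ⟨$⟩ʳ u) ℕ.< toℕ (τ ⟨$⟩ʳ v)) (ι≗ j) (ι≗ k)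
      (proj₂ (same-order j k) σj<σk))

remove-opposite : ∀ {m} (τ ρ : Permutation′ (suc m)) → (∀ i → ρ ⟨$⟩ʳ i ≡ opposite (τ ⟨$⟩ʳ i)) →
                  ∀ p j → remove p ρ ⟨$⟩ʳ j ≡ opposite (remove p τ ⟨$⟩ʳ j)
remove-opposite τ ρ ρ≗δτ p j = trans (punchOut-≡ (ρ≗δτ p) (ρ≗δτ _))
  (punchOut-opposite {i = τ ⟨$⟩ʳ p} {j = τ ⟨$⟩ʳ punchIn p j} _ δτp≢δτq)
  where
  δτp≢δτq : opposite (τ ⟨$⟩ʳ p) ≢ opposite (τ ⟨$⟩ʳ punchIn p j)
  δτp≢δτq e = punchInᵢ≢i p j (sym (⟨$⟩ʳ-injective τ (opposite-injective e)))
  punchOut-≡ : ∀ {n} {i j i′ j′ : Fin (suc n)} {i≢j : i ≢ j} {i≢j′ : i′ ≢ j′} →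
               i ≡ i′ → j ≡ j′ → punchOut i≢j ≡ punchOut i≢j′
  punchOut-≡ {i = i} refl refl = punchOut-cong i refl

deletionsPreserve-opposite : ∀ {m} (L : Partition m) (τ ρ : Permutation′ (suc m)) →
  (∀ i → ρ ⟨$⟩ʳ i ≡ opposite (τ ⟨$⟩ʳ i)) → (∀ x → L (opposite x) ≡ L x) →
  DeletionsPreserve L τ → DeletionsPreserve L ρ
deletionsPreserve-opposite L τ ρ ρ≗δτ L-sym τ-deletions p j =
  trans (cong L (remove-opposite τ ρ ρ≗δτ p j)) (trans (L-sym _) (τ-deletions p j))

opposite-invariant-from-deletions : ∀ {m} (L : Partition m) (τ ρ : Permutation′ (suc m)) →
  (∀ i → ρ ⟨$⟩ʳ i ≡ opposite (τ ⟨$⟩ʳ i)) → DeletionsPreserve L τ → DeletionsPreserve L ρ →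
  ∀ x → L (opposite x) ≡ L x
opposite-invariant-from-deletions L τ ρ ρ≗δτ τ-deletions ρ-deletions x = begin
  L (opposite x)                        ≡⟨ cong (L ∘ opposite) (sym (inverseʳ r)) ⟩
  L (opposite (r ⟨$⟩ʳ j))                ≡⟨ cong L (sym (remove-opposite τ ρ ρ≗δτ zero j)) ⟩
  L (remove zero ρ ⟨$⟩ʳ j)               ≡⟨ ρ-deletions zero j ⟩
  L j                                   ≡⟨ sym (τ-deletions zero j) ⟩
  L (r ⟨$⟩ʳ j)                           ≡⟨ cong L (inverseʳ r) ⟩
  L x                                   ∎
  where
  open ≡-Reasoning
  r = remove zero τ
  j = r ⟨$⟩ˡ x

PairwisePreserve : ∀ {m} → Partition m → Permutation′ (suc m) → Set
PairwisePreserve L σ = ∀ p q (p≢q : p ≢ q) →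
  L (punchOut {i = σ ⟨$⟩ʳ p} {j = σ ⟨$⟩ʳ q} (⟨$⟩ʳ-≢ σ p≢q)) ≡ L (punchOut p≢q)

deletionsPreserve⇒pairwise : ∀ {m} (L : Partition m) (σ : Permutation′ (suc m)) →
                             DeletionsPreserve L σ → PairwisePreserve L σ
deletionsPreserve⇒pairwise L σ deletions p q p≢q =
  trans (cong L (punchOut-cong (σ ⟨$⟩ʳ p) (cong (σ ⟨$⟩ʳ_) (sym (punchIn-punchOut p≢q)))))
        (deletions p (punchOut p≢q))

pairwise⇒deletionsPreserve : ∀ {m} (L : Partition m) (σ : Permutation′ (suc m)) →
                             PairwisePreserve L σ → DeletionsPreserve L σ
pairwise⇒deletionsPreserve L σ pairwise p j =
  trans (cong L (punchOut-cong (σ ⟨$⟩ʳ p) refl))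
        (trans (pairwise p (punchIn p j) (punchInᵢ≢i p j ∘ sym)) (cong L (punchOut-punchIn p)))

Between : ℕ → ℕ → ℕ → Set
Between a b z = (a ℕ.≤ z × z ℕ.≤ b) ⊎ (b ℕ.≤ z × z ℕ.≤ a)

between-right : ∀ a b → Between a b b
between-right a b with ℕₚ.≤-total a b
... | inj₁ a≤b = inj₁ (a≤b , ℕₚ.≤-refl)
... | inj₂ b≤a = inj₂ (ℕₚ.≤-refl , b≤a)

StrictlyOneSide : ℕ → ℕ → ℕ → Set
StrictlyOneSide a b z = (a ℕ.< z × b ℕ.< z) ⊎ (z ℕ.< a × z ℕ.< b)

SameSideOf : ℕ → ℕ → ℕ → Set
SameSideOf c a b = (a ℕ.≤ c → b ℕ.≤ c) × (b ℕ.≤ c → a ℕ.≤ c)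

both-below : ∀ {c x y} → x ℕ.≤ c → y ℕ.≤ c → SameSideOf c x y
both-below x≤c y≤c = (λ _ → y≤c) , (λ _ → x≤c)

both-above : ∀ {c x y} → suc c ℕ.≤ x → suc c ℕ.≤ y → SameSideOf c x y
both-above c<x c<y = (λ x≤c → ⊥-elim (ℕₚ.<⇒≱ c<x x≤c)) , (λ y≤c → ⊥-elim (ℕₚ.<⇒≱ c<y y≤c))

sameSide-sym : ∀ {c a b} → SameSideOf c a b → SameSideOf c b a
sameSide-sym (a→b , b→a) = b→a , a→b

sameSide-trans : ∀ {c a b d} → SameSideOf c a b → SameSideOf c b d → SameSideOf c a d
sameSide-trans (a→b , b→a) (b→d , d→b) = b→d ∘ a→b , b→a ∘ d→b

sameSide-above : ∀ {c a b} → SameSideOf c a b → suc c ℕ.≤ a → suc c ℕ.≤ b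
sameSide-above {c} {a} {b} (_ , b→a) c<a with b ℕ.≤? c
... | yes b≤c = ⊥-elim (ℕₚ.<⇒≱ c<a (b→a b≤c))
... | no b≰c = ℕₚ.≰⇒> b≰c

module Cuts {k : ℕ} (L : Partition (suc k)) where

  -- The value 0 beyond k is junk; it is only ever read at arguments ≤ k.
  label : ℕ → ℕ
  label z with z ℕ.<? suc k
  ... | yes z<n = L (fromℕ< z<n)
  ... | no _ = 0

  label-toℕ : ∀ x → L x ≡ label (toℕ x)
  label-toℕ x with toℕ x ℕ.<? suc k
  ... | yes x<n = cong L (sym (fromℕ<-toℕ x x<n))
  ... | no x≮n = ⊥-elim (x≮n (toℕ<n x))

  Cut : ℕ → Set
  Cut c = suc c ℕ.< suc k × label c ≢ label (suc c)

  label-change⇒jump : ∀ {x y} → x ℕ.≤ y → label x ≢ label y →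
                      Σ ℕ λ c → x ℕ.≤ c × suc c ℕ.≤ y × label c ≢ label (suc c)
  label-change⇒jump {x} {y} x≤y ne =
    let (c , x≤c , c<x+d , jump) = from-offset (y ∸ x) (λ e → ne (trans e (cong label (ℕₚ.m+[n∸m]≡n x≤y))))
    in c , x≤c , subst (suc c ℕ.≤_) (ℕₚ.m+[n∸m]≡n x≤y) c<x+d , jump
    where
    from-offset : ∀ d → label x ≢ label (x + d) →
                  Σ ℕ λ c → x ℕ.≤ c × suc c ℕ.≤ x + d × label c ≢ label (suc c)
    from-offset zero ne = ⊥-elim (ne (cong label (sym (ℕₚ.+-identityʳ x))))
    from-offset (suc d) ne with label x ℕ.≟ label (x + d)
    ... | yes e = x + d , ℕₚ.m≤m+n x d , ℕₚ.≤-reflexive (sym (ℕₚ.+-suc x d)) ,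
                  λ e′ → ne (trans e (trans e′ (cong label (sym (ℕₚ.+-suc x d)))))
    ... | no ne′ = let (c , x≤c , c<x+d , jump) = from-offset d ne′
                   in c , x≤c , ℕₚ.≤-trans c<x+d (ℕₚ.+-monoʳ-≤ x (ℕₚ.n≤1+n d)) , jump

  ConstantOn : ℕ → ℕ → Set
  ConstantOn a b = ∀ z → Between a b z → label z ≡ label a

  constantOn-sym : ∀ {a b} → ConstantOn a b → ConstantOn b a
  constantOn-sym {a} {b} const z z∈ = trans (const z (swap z∈)) (sym (const b (between-right a b)))
    where
    swap : ∀ {z} → Between b a z → Between a b z
    swap (inj₁ z∈) = inj₂ z∈
    swap (inj₂ z∈) = inj₁ z∈

  constant-¬straddles : ∀ {a b c} → ConstantOn a b → Cut c → a ℕ.≤ c → suc c ℕ.≤ b → ⊥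
  constant-¬straddles {c = c} const (_ , jump) a≤c c<b = jump (trans
    (const c (inj₁ (a≤c , ℕₚ.≤-trans (ℕₚ.n≤1+n c) c<b)))
    (sym (const (suc c) (inj₁ (ℕₚ.≤-trans a≤c (ℕₚ.n≤1+n c) , c<b)))))

  constant-¬straddles′ : ∀ {a b c} → ConstantOn a b → Cut c → b ℕ.≤ c → suc c ℕ.≤ a → ⊥
  constant-¬straddles′ const = constant-¬straddles (constantOn-sym const)

  sameSide⇒constantOn : ∀ a b → a ℕ.< suc k → b ℕ.< suc k →
                        (∀ c → Cut c → SameSideOf c a b) → ConstantOn a b
  sameSide⇒constantOn a b a<n b<n same z z∈ with label z ℕ.≟ label a
  ... | yes e = e
  sameSide⇒constantOn a b a<n b<n same z (inj₁ (a≤z , z≤b)) | no ne =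
    let (c , a≤c , c<z , jump) = label-change⇒jump a≤z (ne ∘ sym)
        c<b = ℕₚ.≤-trans c<z z≤b
    in ⊥-elim (ℕₚ.<⇒≱ c<b (proj₁ (same c (ℕₚ.≤-<-trans c<b b<n , jump)) a≤c))
  sameSide⇒constantOn a b a<n b<n same z (inj₂ (b≤z , z≤a)) | no ne =
    let (c , z≤c , c<a , jump) = label-change⇒jump z≤a ne
    in ⊥-elim (ℕₚ.<⇒≱ c<a (proj₂ (same c (ℕₚ.≤-<-trans c<a a<n , jump)) (ℕₚ.≤-trans b≤z z≤c)))

  -- Each cut c of Π̂ yields the singleton block {suc c} of Π′, between the blocks below and above it.
  RespectsCuts : Permutation′ (suc (suc k)) → Set
  RespectsCuts σ = ∀ c → Cut c → ∀ p →
      (toℕ p ℕ.≤ c → toℕ (σ ⟨$⟩ʳ p) ℕ.≤ c)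
    × (toℕ p ≡ suc c → toℕ (σ ⟨$⟩ʳ p) ≡ suc c)
    × (suc c ℕ.< toℕ p → suc c ℕ.< toℕ (σ ⟨$⟩ʳ p))

  respectsCuts-sameSide : ∀ σ → RespectsCuts σ → ∀ c → Cut c → ∀ y → SameSideOf c (toℕ (σ ⟨$⟩ʳ y)) (toℕ y)
  respectsCuts-sameSide σ respects c cut y = backward , proj₁ (respects c cut y)
    where
    backward : toℕ (σ ⟨$⟩ʳ y) ℕ.≤ c → toℕ y ℕ.≤ c
    backward σy≤c with ℕₚ.<-cmp (toℕ y) (suc c)
    ... | tri< y≤c _ _ = ℕ.s≤s⁻¹ y≤c
    ... | tri≈ _ y≡c+1 _ = ⊥-elim (ℕₚ.<⇒≱ (ℕₚ.≤-reflexive (sym (proj₁ (proj₂ (respects c cut y)) y≡c+1))) σy≤c)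
    ... | tri> _ _ c+1<y = ⊥-elim (ℕₚ.<⇒≱ (proj₂ (proj₂ (respects c cut y)) c+1<y) (ℕₚ.m≤n⇒m≤1+n σy≤c))

  respectsCuts-sameSide-suc : ∀ σ → RespectsCuts σ → ∀ c → Cut c → ∀ y →
                              SameSideOf (suc c) (toℕ (σ ⟨$⟩ʳ y)) (toℕ y)
  respectsCuts-sameSide-suc σ respects c cut y = backward , forward
    where
    backward : toℕ (σ ⟨$⟩ʳ y) ℕ.≤ suc c → toℕ y ℕ.≤ suc c
    backward σy≤c+1 with toℕ y ℕ.≤? suc c
    ... | yes y≤c+1 = y≤c+1
    ... | no y≰c+1 = ⊥-elim (ℕₚ.<⇒≱ (proj₂ (proj₂ (respects c cut y)) (ℕₚ.≰⇒> y≰c+1)) σy≤c+1)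
    forward : toℕ y ℕ.≤ suc c → toℕ (σ ⟨$⟩ʳ y) ℕ.≤ suc c
    forward y≤c+1 with ℕₚ.<-cmp (toℕ y) (suc c)
    ... | tri< y≤c _ _ = ℕₚ.m≤n⇒m≤1+n (proj₁ (respects c cut y) (ℕ.s≤s⁻¹ y≤c))
    ... | tri≈ _ y≡c+1 _ = ℕₚ.≤-reflexive (proj₁ (proj₂ (respects c cut y)) y≡c+1)
    ... | tri> _ _ c+1<y = ⊥-elim (ℕₚ.<⇒≱ c+1<y y≤c+1)

  respectsCuts⇒punchOut-sameSide : ∀ σ → RespectsCuts σ → ∀ c → Cut c → ∀ p q (p≢q : p ≢ q) →
    SameSideOf c (toℕ (punchOut {i = σ ⟨$⟩ʳ p} {j = σ ⟨$⟩ʳ q} (⟨$⟩ʳ-≢ σ p≢q))) (toℕ (punchOut p≢q))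
  respectsCuts⇒punchOut-sameSide σ respects c cut p q p≢q
    with ℕₚ.<-cmp (toℕ q) (suc c) | respects c cut p | respects c cut q
  ... | tri< q≤c _ _ | _ | below , _ , _ =
    both-below (ℕₚ.≤-trans (toℕ-punchOut-≤ (⟨$⟩ʳ-≢ σ p≢q)) (below (ℕ.s≤s⁻¹ q≤c)))
               (ℕₚ.≤-trans (toℕ-punchOut-≤ p≢q) (ℕ.s≤s⁻¹ q≤c))
  ... | tri> _ _ c+1<q | _ | _ , _ , above =
    both-above (ℕ.s≤s⁻¹ (ℕₚ.≤-trans (above c+1<q) (toℕ-≤-suc-punchOut (⟨$⟩ʳ-≢ σ p≢q))))
               (ℕ.s≤s⁻¹ (ℕₚ.≤-trans c+1<q (toℕ-≤-suc-punchOut p≢q)))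
  ... | tri≈ _ q≡c+1 _ | p-below , _ , p-above | _ , q-fixed , _ with m≢n⇒m<n⊎n<m (toℕ-≢ p≢q)
  ...   | inj₁ p<q = both-below
            (ℕₚ.≤-reflexive (ℕₚ.suc-injective (trans (suc-toℕ-punchOut-> (⟨$⟩ʳ-≢ σ p≢q) σp<σq) (q-fixed q≡c+1))))
            (ℕₚ.≤-reflexive (ℕₚ.suc-injective (trans (suc-toℕ-punchOut-> p≢q p<q) q≡c+1)))
    where
    σp<σq : toℕ (σ ⟨$⟩ʳ p) ℕ.< toℕ (σ ⟨$⟩ʳ q)
    σp<σq = subst (toℕ (σ ⟨$⟩ʳ p) ℕ.<_) (sym (q-fixed q≡c+1)) (s≤s (p-below (ℕ.s≤s⁻¹ (subst (toℕ p ℕ.<_) q≡c+1 p<q))))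
  ...   | inj₂ q<p = both-above
            (ℕₚ.≤-reflexive (sym (trans (toℕ-punchOut-< (⟨$⟩ʳ-≢ σ p≢q) σq<σp) (q-fixed q≡c+1))))
            (ℕₚ.≤-reflexive (sym (trans (toℕ-punchOut-< p≢q q<p) q≡c+1)))
    where
    σq<σp : toℕ (σ ⟨$⟩ʳ q) ℕ.< toℕ (σ ⟨$⟩ʳ p)
    σq<σp = subst (ℕ._< toℕ (σ ⟨$⟩ʳ p)) (sym (q-fixed q≡c+1)) (p-above (subst (ℕ._< toℕ p) q≡c+1 q<p))

  respectsCuts⇒deletionsPreserve : ∀ σ → RespectsCuts σ → DeletionsPreserve L σ
  respectsCuts⇒deletionsPreserve σ respects = pairwise⇒deletionsPreserve L σ λ p q p≢q →
    let x = punchOut {i = σ ⟨$⟩ʳ p} {j = σ ⟨$⟩ʳ q} (⟨$⟩ʳ-≢ σ p≢q)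
        y = punchOut p≢q
        const = sameSide⇒constantOn (toℕ x) (toℕ y) (toℕ<n x) (toℕ<n y)
                  (λ c cut → respectsCuts⇒punchOut-sameSide σ respects c cut p q p≢q)
    in trans (label-toℕ x) (trans (sym (const (toℕ y) (between-right _ _))) (sym (label-toℕ y)))

  CutsSeparate : Permutation′ (suc (suc k)) → Set
  CutsSeparate σ = ∀ c → Cut c → ∀ p q r → toℕ p ℕ.≤ c → toℕ q ≡ suc c → suc c ℕ.< toℕ r →
                   ¬ StrictlyOneSide (toℕ (σ ⟨$⟩ʳ p)) (toℕ (σ ⟨$⟩ʳ r)) (toℕ (σ ⟨$⟩ʳ q))

  -- Deleting p or r moves q to position c resp. suc c, across the cut, while the value of q
  -- after the deletion is the same when σ p and σ r lie on the same side of σ q.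
  deletionsPreserve⇒cutsSeparate : ∀ σ → DeletionsPreserve L σ → CutsSeparate σ
  deletionsPreserve⇒cutsSeparate σ deletions c (_ , jump) p q r p≤c q≡c+1 c+1<r one-side = jump (begin
    label c                                    ≡⟨ cong label (sym u≡c) ⟩
    label (toℕ (punchOut p≢q))                 ≡⟨ sym (label-toℕ _) ⟩
    L (punchOut p≢q)                           ≡⟨ sym (pairwise p q p≢q) ⟩
    L (punchOut (⟨$⟩ʳ-≢ σ p≢q))                ≡⟨ cong L same-value ⟩
    L (punchOut (⟨$⟩ʳ-≢ σ r≢q))                ≡⟨ pairwise r q r≢q ⟩
    L (punchOut r≢q)                           ≡⟨ label-toℕ _ ⟩
    label (toℕ (punchOut r≢q))                 ≡⟨ cong label v≡c+1 ⟩
    label (suc c)                              ∎)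
    where
    open ≡-Reasoning
    pairwise = deletionsPreserve⇒pairwise L σ deletions
    p<q : toℕ p ℕ.< toℕ q
    p<q = subst (toℕ p ℕ.<_) (sym q≡c+1) (s≤s p≤c)
    q<r : toℕ q ℕ.< toℕ r
    q<r = subst (ℕ._< toℕ r) (sym q≡c+1) c+1<r
    p≢q : p ≢ q
    p≢q e = ℕₚ.<-irrefl (cong toℕ e) p<q
    r≢q : r ≢ q
    r≢q e = ℕₚ.<-irrefl (cong toℕ (sym e)) q<r
    u≡c : toℕ (punchOut p≢q) ≡ c
    u≡c = ℕₚ.suc-injective (trans (suc-toℕ-punchOut-> p≢q p<q) q≡c+1)
    v≡c+1 : toℕ (punchOut r≢q) ≡ suc c
    v≡c+1 = trans (toℕ-punchOut-< r≢q q<r) q≡c+1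
    same-value : punchOut (⟨$⟩ʳ-≢ σ p≢q) ≡ punchOut (⟨$⟩ʳ-≢ σ r≢q)
    same-value = toℕ-injective ([
      (λ (σp<σq , σr<σq) → ℕₚ.suc-injective (trans (suc-toℕ-punchOut-> (⟨$⟩ʳ-≢ σ p≢q) σp<σq)
                                                  (sym (suc-toℕ-punchOut-> (⟨$⟩ʳ-≢ σ r≢q) σr<σq)))) ,
      (λ (σq<σp , σq<σr) → trans (toℕ-punchOut-< (⟨$⟩ʳ-≢ σ p≢q) σq<σp)
                                 (sym (toℕ-punchOut-< (⟨$⟩ʳ-≢ σ r≢q) σq<σr))) ]′ one-side)

  cutsSeparate-reverse : ∀ τ → CutsSeparate τ → CutsSeparate (τ ∘ₚ Perm.reverse)
  cutsSeparate-reverse τ separates c cut p q r p≤c q≡c+1 c+1<r (inj₁ (a , b)) =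
    separates c cut p q r p≤c q≡c+1 c+1<r (inj₂ (opposite-reflects-< a , opposite-reflects-< b))
  cutsSeparate-reverse τ separates c cut p q r p≤c q≡c+1 c+1<r (inj₂ (a , b)) =
    separates c cut p q r p≤c q≡c+1 c+1<r (inj₁ (opposite-reflects-< a , opposite-reflects-< b))

  module Separating (σ : Permutation′ (suc (suc k))) (separates : CutsSeparate σ)
                    (ends : toℕ (σ ⟨$⟩ʳ zero) ℕ.< toℕ (σ ⟨$⟩ʳ fromℕ (suc k)))
                    (c : ℕ) (cut : Cut c) (q : Fin (suc (suc k))) (q≡c+1 : toℕ q ≡ suc c) where

    private
      last = fromℕ (suc k)

      q<last : toℕ q ℕ.< toℕ last
      q<last = subst₂ ℕ._<_ (sym q≡c+1) (sym (toℕ-fromℕ (suc k))) (proj₁ cut)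

      c+1<last : suc c ℕ.< toℕ last
      c+1<last = subst (ℕ._< toℕ last) q≡c+1 q<last

      compare : ∀ {a b} → toℕ a ≢ toℕ b → toℕ (σ ⟨$⟩ʳ a) ℕ.< toℕ (σ ⟨$⟩ʳ b) ⊎ toℕ (σ ⟨$⟩ʳ b) ℕ.< toℕ (σ ⟨$⟩ʳ a)
      compare a≢b = m≢n⇒m<n⊎n<m (toℕ-≢ (⟨$⟩ʳ-≢ σ (a≢b ∘ cong toℕ)))

    σ0<σq : toℕ (σ ⟨$⟩ʳ zero) ℕ.< toℕ (σ ⟨$⟩ʳ q)
    σ0<σq with compare {zero} {q} (λ e → ℕₚ.0≢1+n (trans e q≡c+1))
    ... | inj₁ σ0<σq = σ0<σq
    ... | inj₂ σq<σ0 with compare {q} {last} (ℕₚ.<⇒≢ q<last)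
    ...   | inj₁ σq<σl = ⊥-elim (separates c cut zero q last z≤n q≡c+1 c+1<last (inj₂ (σq<σ0 , σq<σl)))
    ...   | inj₂ σl<σq = ⊥-elim (ℕₚ.<-asym ends (ℕₚ.<-trans σl<σq σq<σ0))

    σq<σlast : toℕ (σ ⟨$⟩ʳ q) ℕ.< toℕ (σ ⟨$⟩ʳ last)
    σq<σlast with compare {q} {last} (ℕₚ.<⇒≢ q<last)
    ... | inj₁ σq<σl = σq<σl
    ... | inj₂ σl<σq = ⊥-elim (separates c cut zero q last z≤n q≡c+1 c+1<last (inj₁ (σ0<σq , σl<σq)))

    below-q : ∀ p → toℕ p ℕ.< toℕ q → toℕ (σ ⟨$⟩ʳ p) ℕ.< toℕ (σ ⟨$⟩ʳ q)
    below-q p p<q with compare (ℕₚ.<⇒≢ p<q)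
    ... | inj₁ σp<σq = σp<σq
    ... | inj₂ σq<σp = ⊥-elim (separates c cut p q last (ℕ.s≤s⁻¹ (subst (toℕ p ℕ.<_) q≡c+1 p<q)) q≡c+1 c+1<last
                                         (inj₂ (σq<σp , σq<σlast)))

    above-q : ∀ r → toℕ q ℕ.< toℕ r → toℕ (σ ⟨$⟩ʳ q) ℕ.< toℕ (σ ⟨$⟩ʳ r)
    above-q r q<r with compare (ℕₚ.<⇒≢ q<r)
    ... | inj₁ σq<σr = σq<σr
    ... | inj₂ σr<σq = ⊥-elim (separates c cut zero q r z≤n q≡c+1 (subst (ℕ._< toℕ r) q≡c+1 q<r) (inj₁ (σ0<σq , σr<σq)))

    -- Counting: σ injects the positions below q into the values below σ q, and σ⁻¹ does the converse.
    σq≡c+1 : toℕ (σ ⟨$⟩ʳ q) ≡ suc c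
    σq≡c+1 = trans (ℕₚ.≤-antisym σq≤q q≤σq) q≡c+1
      where
      q≤σq : toℕ q ℕ.≤ toℕ (σ ⟨$⟩ʳ q)
      q≤σq = injection-into-prefix⇒≤ (σ ⟨$⟩ʳ_) (⟨$⟩ʳ-injective σ) (toℕ q) _ (ℕₚ.<⇒≤ (toℕ<n q)) below-q
      σ⁻¹-below : ∀ v → toℕ v ℕ.< toℕ (σ ⟨$⟩ʳ q) → toℕ (σ ⟨$⟩ˡ v) ℕ.< toℕ q
      σ⁻¹-below v v<σq with m≢n⇒m<n⊎n<m {toℕ (σ ⟨$⟩ˡ v)} {toℕ q}
                               (λ e → ℕₚ.<⇒≢ v<σq (cong toℕ (trans (sym (inverseʳ σ)) (cong (σ ⟨$⟩ʳ_) (toℕ-injective e)))))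
      ... | inj₁ σ⁻¹v<q = σ⁻¹v<q
      ... | inj₂ q<σ⁻¹v = ⊥-elim (ℕₚ.<-asym v<σq (subst (λ z → toℕ (σ ⟨$⟩ʳ q) ℕ.< toℕ z) (inverseʳ σ) (above-q _ q<σ⁻¹v)))
      σq≤q : toℕ (σ ⟨$⟩ʳ q) ℕ.≤ toℕ q
      σq≤q = injection-into-prefix⇒≤ (σ ⟨$⟩ˡ_) (⟨$⟩ʳ-injective (Perm.flip σ)) _ (toℕ q) (ℕₚ.<⇒≤ (toℕ<n _)) σ⁻¹-below

  cutsSeparate⇒respectsCuts : ∀ σ → CutsSeparate σ → toℕ (σ ⟨$⟩ʳ zero) ℕ.< toℕ (σ ⟨$⟩ʳ fromℕ (suc k)) →
                              RespectsCuts σ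
  cutsSeparate⇒respectsCuts σ separates ends c cut p =
      (λ p≤c → ℕ.s≤s⁻¹ (subst (toℕ (σ ⟨$⟩ʳ p) ℕ.<_) σq≡c+1 (below-q p (subst (toℕ p ℕ.<_) (sym q≡c+1) (s≤s p≤c)))))
    , (λ p≡c+1 → Separating.σq≡c+1 σ separates ends c cut p p≡c+1)
    , (λ c+1<p → subst (ℕ._< toℕ (σ ⟨$⟩ʳ p)) σq≡c+1 (above-q p (subst (ℕ._< toℕ p) (sym q≡c+1) c+1<p)))
    where
    c+1<n : suc c ℕ.< suc (suc k)
    c+1<n = ℕₚ.<-trans (proj₁ cut) (ℕₚ.n<1+n (suc k))
    q = fromℕ< c+1<n
    q≡c+1 = toℕ-fromℕ< c+1<n
    open Separating σ separates ends c cut q q≡c+1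

  deletionsPreserve⇒respectsCuts⊎reversed : ∀ τ → DeletionsPreserve L τ →
                                            RespectsCuts τ ⊎ RespectsCuts (τ ∘ₚ Perm.reverse)
  deletionsPreserve⇒respectsCuts⊎reversed τ deletions =
    map (cutsSeparate⇒respectsCuts τ separates)
        (cutsSeparate⇒respectsCuts (τ ∘ₚ Perm.reverse) (cutsSeparate-reverse τ separates) ∘ opposite-reverses-<)
        (m≢n⇒m<n⊎n<m (toℕ-≢ (⟨$⟩ʳ-≢ τ {zero} {fromℕ (suc k)} λ ())))
    where separates = deletionsPreserve⇒cutsSeparate τ deletions

shiftDown : ∀ {k} → Fin (suc (suc k)) → Fin (suc k)
shiftDown zero = zero
shiftDown (suc i) = i

hat¹-shiftDown : ∀ {k} (H : Partition (suc k)) x → hat¹ H x ≡ H (shiftDown x)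
hat¹-shiftDown H zero = refl
hat¹-shiftDown H (suc i) = refl

toℕ-shiftDown : ∀ {k} (x : Fin (suc (suc k))) → toℕ (shiftDown x) ≡ pred (toℕ x)
toℕ-shiftDown zero = refl
toℕ-shiftDown (suc i) = refl

shiftDown-≤⇔ : ∀ {k} c (v : Fin (suc (suc k))) →
               (toℕ (shiftDown v) ℕ.≤ c → toℕ v ℕ.≤ suc c) × (toℕ v ℕ.≤ suc c → toℕ (shiftDown v) ℕ.≤ c)
shiftDown-≤⇔ c zero = (λ _ → z≤n) , (λ _ → z≤n)
shiftDown-≤⇔ c (suc i) = s≤s , ℕ.s≤s⁻¹

clamp-cases : ∀ {k} (x : Fin (suc (suc k))) →
              (toℕ x ℕ.≤ k × toℕ (clamp x) ≡ toℕ x) ⊎ (toℕ x ≡ suc k × toℕ (clamp x) ≡ k)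
clamp-cases {zero} zero = inj₁ (z≤n , refl)
clamp-cases {zero} (suc zero) = inj₂ (refl , refl)
clamp-cases {suc k} zero = inj₁ (z≤n , refl)
clamp-cases {suc k} (suc x) with clamp-cases x
... | inj₁ (x≤k , e) = inj₁ (s≤s x≤k , cong suc e)
... | inj₂ (x≡k+1 , e) = inj₂ (cong suc x≡k+1 , cong suc e)

clamp-sameSide : ∀ {k c} → c ℕ.< k → ∀ (v : Fin (suc (suc k))) → SameSideOf c (toℕ (clamp v)) (toℕ v)
clamp-sameSide {k} {c} c<k v with clamp-cases v
... | inj₁ (_ , e) = subst (λ z → SameSideOf c z (toℕ v)) (sym e) (id , id)
... | inj₂ (v≡k+1 , e) = both-above (subst (suc c ℕ.≤_) (sym e) c<k)
                                    (subst (suc c ℕ.≤_) (sym v≡k+1) (ℕₚ.m≤n⇒m≤1+n c<k))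

pairPartition : ∀ {m} → Fin m → Fin m → Partition m
pairPartition x y z with z Fin.≟ x | z Fin.≟ y
... | yes _ | _ = 0
... | no _ | yes _ = 0
... | no _ | no _ = suc (toℕ z)

pairPartition-cases : ∀ {m} (x y z : Fin m) → ((z ≡ x ⊎ z ≡ y) × pairPartition x y z ≡ 0)
                      ⊎ (z ≢ x × z ≢ y × pairPartition x y z ≡ suc (toℕ z))
pairPartition-cases x y z with z Fin.≟ x | z Fin.≟ y
... | yes z≡x | _ = inj₁ (inj₁ z≡x , refl)
... | no _ | yes z≡y = inj₁ (inj₂ z≡y , refl)
... | no z≢x | no z≢y = inj₂ (z≢x , z≢y , refl)

pairPartition-sameBlock : ∀ {m} (x y : Fin m) → SameBlock (pairPartition x y) x y
pairPartition-sameBlock x y = trans (zero-on x (inj₁ refl)) (sym (zero-on y (inj₂ refl)))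
  where
  zero-on : ∀ z → z ≡ x ⊎ z ≡ y → pairPartition x y z ≡ 0
  zero-on z z∈ with pairPartition-cases x y z
  ... | inj₁ (_ , e) = e
  ... | inj₂ (z≢x , z≢y , _) = ⊥-elim ([ z≢x , z≢y ]′ z∈)

pairPartition-refines : ∀ {m} (P : Partition m) (x y : Fin m) → SameBlock P x y → Refines (pairPartition x y) P
pairPartition-refines P x y Pxy u v same with pairPartition-cases x y u | pairPartition-cases x y v
... | inj₁ (inj₁ refl , _) | inj₁ (inj₁ refl , _) = refl
... | inj₁ (inj₁ refl , _) | inj₁ (inj₂ refl , _) = Pxy
... | inj₁ (inj₂ refl , _) | inj₁ (inj₁ refl , _) = sym Pxy
... | inj₁ (inj₂ refl , _) | inj₁ (inj₂ refl , _) = refl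
... | inj₁ (_ , u0) | inj₂ (_ , _ , v+) = ⊥-elim (ℕₚ.0≢1+n (trans (sym u0) (trans same v+)))
... | inj₂ (_ , _ , u+) | inj₁ (_ , v0) = ⊥-elim (ℕₚ.0≢1+n (trans (sym v0) (trans (sym same) u+)))
... | inj₂ (_ , _ , u+) | inj₂ (_ , _ , v+) =
  cong P (toℕ-injective (ℕₚ.suc-injective (trans (sym u+) (trans same v+))))

intervalPartition : ∀ {m} → ℕ → ℕ → Partition m
intervalPartition a b z with (a ℕ.≤? toℕ z) ×-dec (toℕ z ℕ.≤? b)
... | yes _ = 0
... | no _ = suc (toℕ z)

intervalPartition-cases : ∀ {m} a b (z : Fin m) →
  ((a ℕ.≤ toℕ z × toℕ z ℕ.≤ b) × intervalPartition a b z ≡ 0)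
  ⊎ (¬ (a ℕ.≤ toℕ z × toℕ z ℕ.≤ b) × intervalPartition a b z ≡ suc (toℕ z))
intervalPartition-cases a b z with (a ℕ.≤? toℕ z) ×-dec (toℕ z ℕ.≤? b)
... | yes z∈ = inj₁ (z∈ , refl)
... | no z∉ = inj₂ (z∉ , refl)

intervalPartition-isInterval : ∀ {m} a b → IsIntervalPartition (intervalPartition {m} a b)
intervalPartition-isInterval a b x y z x≤y y≤z same
  with intervalPartition-cases a b x | intervalPartition-cases a b y | intervalPartition-cases a b z
... | inj₁ (_ , x0) | inj₁ (_ , y0) | _ = trans x0 (sym y0)
... | inj₁ ((a≤x , _) , _) | inj₂ (y∉ , _) | inj₁ ((_ , z≤b) , _) = ⊥-elim (y∉ (ℕₚ.≤-trans a≤x x≤y , ℕₚ.≤-trans y≤z z≤b))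
... | inj₁ (_ , x0) | inj₂ _ | inj₂ (_ , z+) = ⊥-elim (ℕₚ.0≢1+n (trans (sym x0) (trans same z+)))
... | inj₂ (_ , x+) | _ | inj₁ (_ , z0) = ⊥-elim (ℕₚ.0≢1+n (trans (sym z0) (trans (sym same) x+)))
... | inj₂ (_ , x+) | _ | inj₂ (_ , z+) =
  cong (intervalPartition a b) (toℕ-injective (ℕₚ.≤-antisym x≤y (ℕₚ.≤-trans y≤z (ℕₚ.≤-reflexive (sym x≡z)))))
  where
  x≡z : toℕ x ≡ toℕ z
  x≡z = ℕₚ.suc-injective (trans (sym x+) (trans same z+))

-- δ maps intervals to intervals, so H ∘ δ is an interval partition refining P ∘ δ = P, hence refining H.
coarsestIntervalRefinement-opposite : ∀ {n} {P H : Partition n} → IsCoarsestIntervalRefinement P H →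
  (∀ x → P (opposite x) ≡ P x) → ∀ x y → H x ≡ H y → H (opposite x) ≡ H (opposite y)
coarsestIntervalRefinement-opposite {P = P} {H} (H-interval , H-refines , H-coarsest) P-opposite x y same =
  H-coarsest (H ∘ opposite) Hδ-interval Hδ-refines (opposite x) (opposite y)
    (subst₂ (λ u v → H u ≡ H v) (sym (opposite-involutive x)) (sym (opposite-involutive y)) same)
  where
  Hδ-interval : IsIntervalPartition (H ∘ opposite)
  Hδ-interval u v w u≤v v≤w Hδu≡Hδw = trans Hδu≡Hδw (H-interval (opposite w) (opposite v) (opposite u)
    (opposite-reverses-≤ v≤w) (opposite-reverses-≤ u≤v) (sym Hδu≡Hδw))
  Hδ-refines : Refines (H ∘ opposite) P
  Hδ-refines u v same′ = trans (sym (P-opposite u)) (trans (H-refines _ _ same′) (P-opposite v))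

shiftDown-opposite : ∀ {k} (x : Fin (suc (suc k))) → shiftDown (opposite x) ≡ opposite (clamp x)
shiftDown-opposite {k} x = toℕ-injective (begin
  toℕ (shiftDown (opposite x))  ≡⟨ toℕ-shiftDown (opposite x) ⟩
  pred (toℕ (opposite x))       ≡⟨ cong pred (opposite-prop x) ⟩
  pred (suc k ∸ toℕ x)          ≡⟨ ℕₚ.pred[m∸n]≡m∸[1+n] (suc k) (toℕ x) ⟩
  k ∸ toℕ x                     ≡⟨ k∸x≡k∸clamp ⟩
  k ∸ toℕ (clamp x)             ≡⟨ sym (opposite-prop (clamp x)) ⟩
  toℕ (opposite (clamp x))      ∎)
  where
  open ≡-Reasoning
  k∸x≡k∸clamp : k ∸ toℕ x ≡ k ∸ toℕ (clamp x)
  k∸x≡k∸clamp with clamp-cases x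
  ... | inj₁ (_ , clamp≡x) = cong (k ∸_) (sym clamp≡x)
  ... | inj₂ (x≡k+1 , clamp≡k) = trans (cong (k ∸_) x≡k+1)
    (trans (ℕₚ.m≤n⇒m∸n≡0 (ℕₚ.n≤1+n k)) (trans (sym (ℕₚ.n∸n≡0 k)) (cong (k ∸_) (sym clamp≡k))))

clamp-opposite : ∀ {k} (x : Fin (suc (suc k))) → clamp (opposite x) ≡ opposite (shiftDown x)
clamp-opposite x = begin
  clamp (opposite x)                           ≡⟨ sym (opposite-involutive _) ⟩
  opposite (opposite (clamp (opposite x)))     ≡⟨ cong opposite (sym (shiftDown-opposite (opposite x))) ⟩
  opposite (shiftDown (opposite (opposite x))) ≡⟨ cong (opposite ∘ shiftDown) (opposite-involutive x) ⟩
  opposite (shiftDown x)                       ∎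
  where open ≡-Reasoning

∘reverse⇒coset : ∀ {n} (A : PermSet n) (τ : Permutation′ n) → A (τ ∘ₚ Perm.reverse) → (δ n · A) τ
∘reverse⇒coset A τ τδ∈A = τ ∘ₚ Perm.reverse , τδ∈A , λ i → sym (opposite-involutive (τ ⟨$⟩ʳ i))

module _ {n} (P : Partition n) (P-opposite : ∀ x y → P x ≡ P y → P (opposite x) ≡ P (opposite y)) where

  δσδ-preserves : ∀ σ → S[ P ] σ → ∀ x → P (opposite (σ ⟨$⟩ʳ opposite x)) ≡ P x
  δσδ-preserves σ σ∈S x = trans (P-opposite _ _ (proj₁ σ∈S (opposite x))) (cong P (opposite-involutive x))

  ∪coset-∘ : ∀ {σ ρ τ} → (S[ P ] ∪ (δ n · S[ P ])) σ → (S[ P ] ∪ (δ n · S[ P ])) ρ →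
             (∀ i → τ ⟨$⟩ʳ i ≡ σ ⟨$⟩ʳ (ρ ⟨$⟩ʳ i)) → (S[ P ] ∪ (δ n · S[ P ])) τ
  ∪coset-∘ {σ} {ρ} {τ} σ∈ ρ∈ τ≗σρ with σ∈ | ρ∈
  ... | inj₁ σ∈S | inj₁ ρ∈S = inj₁ (S[]-intro P τ λ x →
          trans (cong P (τ≗σρ x)) (trans (proj₁ σ∈S _) (proj₁ ρ∈S x)))
  ... | inj₁ σ∈S | inj₂ (ρ′ , ρ′∈S , ρ≗δρ′) = inj₂ (ζ , S[]-intro P ζ ζ-preserves , λ i →
          trans (τ≗σρ i) (trans (cong (σ ⟨$⟩ʳ_) (ρ≗δρ′ i)) (sym (opposite-involutive (σ ⟨$⟩ʳ opposite (ρ′ ⟨$⟩ʳ i))))))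
    where
    ζ = ((ρ′ ∘ₚ Perm.reverse) ∘ₚ σ) ∘ₚ Perm.reverse
    ζ-preserves : ∀ x → P (ζ ⟨$⟩ʳ x) ≡ P x
    ζ-preserves x = trans (δσδ-preserves σ σ∈S (ρ′ ⟨$⟩ʳ x)) (proj₁ ρ′∈S x)
  ... | inj₂ (σ′ , σ′∈S , σ≗δσ′) | inj₁ ρ∈S = inj₂ (ρ ∘ₚ σ′ ,
          S[]-intro P (ρ ∘ₚ σ′) (λ x → trans (proj₁ σ′∈S _) (proj₁ ρ∈S x)) , λ i → trans (τ≗σρ i) (σ≗δσ′ _))
  ... | inj₂ (σ′ , σ′∈S , σ≗δσ′) | inj₂ (ρ′ , ρ′∈S , ρ≗δρ′) = inj₁ (S[]-intro P τ λ x →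
          trans (cong P (trans (τ≗σρ x) (trans (σ≗δσ′ _) (cong (λ z → opposite (σ′ ⟨$⟩ʳ z)) (ρ≗δρ′ x)))))
                (trans (δσδ-preserves σ′ σ′∈S (ρ′ ⟨$⟩ʳ x)) (proj₁ ρ′∈S x)))
  ∪coset-inverse : ∀ {σ τ} → (S[ P ] ∪ (δ n · S[ P ])) σ → (∀ i → τ ⟨$⟩ʳ (σ ⟨$⟩ʳ i) ≡ i) →
                   (S[ P ] ∪ (δ n · S[ P ])) τ
  ∪coset-inverse {σ} {τ} σ∈ τσ≗id with σ∈
  ... | inj₁ σ∈S = inj₁ (S[]-intro P τ λ x → begin
          P (τ ⟨$⟩ʳ x)                         ≡⟨ cong P (τ≗σ⁻¹ x) ⟩
          P (σ ⟨$⟩ˡ x)                         ≡⟨ sym (proj₁ σ∈S _) ⟩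
          P (σ ⟨$⟩ʳ (σ ⟨$⟩ˡ x))                ≡⟨ cong P (inverseʳ σ) ⟩
          P x                                  ∎)
    where
    open ≡-Reasoning
    τ≗σ⁻¹ : ∀ x → τ ⟨$⟩ʳ x ≡ σ ⟨$⟩ˡ x
    τ≗σ⁻¹ x = trans (cong (τ ⟨$⟩ʳ_) (sym (inverseʳ σ))) (τσ≗id _)
  ... | inj₂ (σ′ , σ′∈S , σ≗δσ′) = inj₂ (ζ , S[]-intro P ζ ζ-preserves , λ i → sym (opposite-involutive (τ ⟨$⟩ʳ i)))
    where
    open ≡-Reasoning
    ζ = τ ∘ₚ Perm.reverse
    ζ-preserves : ∀ x → P (opposite (τ ⟨$⟩ʳ x)) ≡ P x
    ζ-preserves x = begin
      P (opposite (τ ⟨$⟩ʳ x))                  ≡⟨ cong (P ∘ opposite) τx≡σ⁻¹x ⟩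
      P (opposite (σ ⟨$⟩ˡ x))                  ≡⟨ P-opposite _ _ (sym (proj₁ σ′∈S (σ ⟨$⟩ˡ x))) ⟩
      P (opposite (σ′ ⟨$⟩ʳ (σ ⟨$⟩ˡ x)))        ≡⟨ cong P (sym (σ≗δσ′ _)) ⟩
      P (σ ⟨$⟩ʳ (σ ⟨$⟩ˡ x))                    ≡⟨ cong P (inverseʳ σ) ⟩
      P x                                      ∎
      where
      τx≡σ⁻¹x : τ ⟨$⟩ʳ x ≡ σ ⟨$⟩ˡ x
      τx≡σ⁻¹x = trans (cong (τ ⟨$⟩ʳ_) (sym (inverseʳ σ))) (τσ≗id _)

  generated⇒∪coset : ∀ {τ} → Generated S[ P ] (δ n) τ → (S[ P ] ∪ (δ n · S[ P ])) τ
  generated⇒∪coset (gen-set τ∈S) = inj₁ τ∈S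
  generated⇒∪coset gen-elt = inj₂ (Perm.id , S[]-intro P Perm.id (λ _ → refl) , λ _ → refl)
  generated⇒∪coset {τ} (gen-id τ≗id) = inj₁ (S[]-intro P τ (cong P ∘ τ≗id))
  generated⇒∪coset {τ} (gen-∘ {σ} {ρ} σ∈G ρ∈G τ≗σρ) =
    ∪coset-∘ {σ} {ρ} {τ} (generated⇒∪coset σ∈G) (generated⇒∪coset ρ∈G) τ≗σρ
  generated⇒∪coset {τ} (gen-inv {σ} σ∈G τσ≗id) = ∪coset-inverse {σ} {τ} (generated⇒∪coset σ∈G) τσ≗id

  ∪coset⇒generated : ∀ {τ} → (S[ P ] ∪ (δ n · S[ P ])) τ → Generated S[ P ] (δ n) τ
  ∪coset⇒generated (inj₁ τ∈S) = gen-set τ∈S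
  ∪coset⇒generated (inj₂ (σ , σ∈S , τ≗δσ)) = gen-∘ {σ = δ n} {ρ = σ} gen-elt (gen-set σ∈S) τ≗δσ

module Refinements {k : ℕ} {Π Π̂ : Partition (suc k)} {Π′ : Partition (suc (suc k))}
                   (Π̂-coarsest : IsCoarsestIntervalRefinement Π Π̂)
                   (Π′-coarsest : IsCoarsestCommonRefinement (hat¹ Π̂) (hatⁿ⁺¹ Π̂) Π′) where
  open Cuts Π

  Π̂-block⇒label-constant : ∀ x y → Π̂ x ≡ Π̂ y → ∀ z → toℕ x ℕ.≤ z → z ℕ.≤ toℕ y → label z ≡ label (toℕ x)
  Π̂-block⇒label-constant x y same z x≤z z≤y = begin
    label z        ≡⟨ cong label (sym w≡z) ⟩
    label (toℕ w)  ≡⟨ sym (label-toℕ w) ⟩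
    Π w            ≡⟨ sym (proj₁ (proj₂ Π̂-coarsest) x w Π̂x≡Π̂w) ⟩
    Π x            ≡⟨ label-toℕ x ⟩
    label (toℕ x)  ∎
    where
    open ≡-Reasoning
    w = fromℕ< (ℕₚ.≤-<-trans z≤y (toℕ<n y))
    w≡z : toℕ w ≡ z
    w≡z = toℕ-fromℕ< _
    Π̂x≡Π̂w : Π̂ x ≡ Π̂ w
    Π̂x≡Π̂w = proj₁ Π̂-coarsest x w y (subst (toℕ x ℕ.≤_) (sym w≡z) x≤z) (subst (ℕ._≤ toℕ y) (sym w≡z) z≤y) same

  Π̂-block⇒constantOn : ∀ x y → Π̂ x ≡ Π̂ y → ConstantOn (toℕ x) (toℕ y)
  Π̂-block⇒constantOn x y same z (inj₁ (x≤z , z≤y)) = Π̂-block⇒label-constant x y same z x≤z z≤y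
  Π̂-block⇒constantOn x y same z (inj₂ (y≤z , z≤x)) =
    trans (Π̂-block⇒label-constant y x (sym same) z y≤z z≤x)
          (sym (Π̂-block⇒label-constant y x (sym same) (toℕ x) (ℕₚ.≤-trans y≤z z≤x) ℕₚ.≤-refl))

  -- The interval [x, y] is a block of an interval partition refining Π.
  constantOn⇒Π̂-block-≤ : ∀ x y → toℕ x ℕ.≤ toℕ y → ConstantOn (toℕ x) (toℕ y) → Π̂ x ≡ Π̂ y
  constantOn⇒Π̂-block-≤ x y x≤y const = proj₂ (proj₂ Π̂-coarsest) K (intervalPartition-isInterval (toℕ x) (toℕ y))
    K-refines x y (trans (K-inside x (ℕₚ.≤-refl , x≤y)) (sym (K-inside y (x≤y , ℕₚ.≤-refl))))
    where
    K = intervalPartition {suc k} (toℕ x) (toℕ y)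
    K-inside : ∀ z → (toℕ x ℕ.≤ toℕ z × toℕ z ℕ.≤ toℕ y) → K z ≡ 0
    K-inside z z∈ with intervalPartition-cases (toℕ x) (toℕ y) z
    ... | inj₁ (_ , e) = e
    ... | inj₂ (z∉ , _) = ⊥-elim (z∉ z∈)
    K-refines : Refines K Π
    K-refines u v same with intervalPartition-cases (toℕ x) (toℕ y) u | intervalPartition-cases (toℕ x) (toℕ y) v
    ... | inj₁ (u∈ , _) | inj₁ (v∈ , _) =
      trans (label-toℕ u) (trans (const _ (inj₁ u∈)) (sym (trans (label-toℕ v) (const _ (inj₁ v∈)))))
    ... | inj₁ (_ , u0) | inj₂ (_ , v+) = ⊥-elim (ℕₚ.0≢1+n (trans (sym u0) (trans same v+)))
    ... | inj₂ (_ , u+) | inj₁ (_ , v0) = ⊥-elim (ℕₚ.0≢1+n (trans (sym v0) (trans (sym same) u+)))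
    ... | inj₂ (_ , u+) | inj₂ (_ , v+) = cong Π (toℕ-injective (ℕₚ.suc-injective (trans (sym u+) (trans same v+))))

  constantOn⇒Π̂-block : ∀ x y → ConstantOn (toℕ x) (toℕ y) → Π̂ x ≡ Π̂ y
  constantOn⇒Π̂-block x y const with ℕₚ.≤-total (toℕ x) (toℕ y)
  ... | inj₁ x≤y = constantOn⇒Π̂-block-≤ x y x≤y const
  ... | inj₂ y≤x = sym (constantOn⇒Π̂-block-≤ y x y≤x (constantOn-sym const))

  Π′-block⇒ : ∀ x y → Π′ x ≡ Π′ y → Π̂ (clamp x) ≡ Π̂ (clamp y) × Π̂ (shiftDown x) ≡ Π̂ (shiftDown y)
  Π′-block⇒ x y same = proj₁ (proj₂ Π′-coarsest) x y same
                     , trans (sym (hat¹-shiftDown Π̂ x)) (trans (proj₁ Π′-coarsest x y same) (hat¹-shiftDown Π̂ y))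

  Π′-block⇐ : ∀ x y → Π̂ (clamp x) ≡ Π̂ (clamp y) → Π̂ (shiftDown x) ≡ Π̂ (shiftDown y) → Π′ x ≡ Π′ y
  Π′-block⇐ x y same-clamp same-shift = proj₂ (proj₂ Π′-coarsest) (pairPartition x y)
    (pairPartition-refines (hat¹ Π̂) x y (trans (hat¹-shiftDown Π̂ x) (trans same-shift (sym (hat¹-shiftDown Π̂ y)))))
    (pairPartition-refines (hatⁿ⁺¹ Π̂) x y same-clamp)
    x y (pairPartition-sameBlock x y)

  S[Π′]⇒respectsCuts : ∀ σ → S[ Π′ ] σ → RespectsCuts σ
  S[Π′]⇒respectsCuts σ σ∈S c cut p = below , fixed , above
    where
    c<k : c ℕ.< k
    c<k = ℕ.s≤s⁻¹ (proj₁ cut)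
    blocks = Π′-block⇒ (σ ⟨$⟩ʳ p) p (proj₁ σ∈S p)
    clamp-const : ConstantOn (toℕ (clamp (σ ⟨$⟩ʳ p))) (toℕ (clamp p))
    clamp-const = Π̂-block⇒constantOn _ _ (proj₁ blocks)
    shift-const : ConstantOn (toℕ (shiftDown (σ ⟨$⟩ʳ p))) (toℕ (shiftDown p))
    shift-const = Π̂-block⇒constantOn _ _ (proj₂ blocks)
    clamp-≤ : ∀ v → toℕ v ℕ.≤ c → toℕ (clamp v) ℕ.≤ c
    clamp-≤ v = proj₂ (clamp-sameSide c<k v)
    clamp-> : ∀ v → suc c ℕ.≤ toℕ v → suc c ℕ.≤ toℕ (clamp v)
    clamp-> v = sameSide-above (sameSide-sym (clamp-sameSide c<k v))
    shift-≤ : ∀ v → toℕ v ℕ.≤ suc c → toℕ (shiftDown v) ℕ.≤ c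
    shift-≤ v = proj₂ (shiftDown-≤⇔ c v)
    shift-> : ∀ v → suc (suc c) ℕ.≤ toℕ v → suc c ℕ.≤ toℕ (shiftDown v)
    shift-> v c+1<v with toℕ (shiftDown v) ℕ.≤? c
    ... | yes s≤c = ⊥-elim (ℕₚ.<⇒≱ c+1<v (proj₁ (shiftDown-≤⇔ c v) s≤c))
    ... | no s≰c = ℕₚ.≰⇒> s≰c
    below : toℕ p ℕ.≤ c → toℕ (σ ⟨$⟩ʳ p) ℕ.≤ c
    below p≤c with toℕ (σ ⟨$⟩ʳ p) ℕ.≤? c
    ... | yes σp≤c = σp≤c
    ... | no σp≰c = ⊥-elim (constant-¬straddles′ clamp-const cut (clamp-≤ p p≤c) (clamp-> _ (ℕₚ.≰⇒> σp≰c)))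
    fixed : toℕ p ≡ suc c → toℕ (σ ⟨$⟩ʳ p) ≡ suc c
    fixed p≡c+1 with ℕₚ.<-cmp (toℕ (σ ⟨$⟩ʳ p)) (suc c)
    ... | tri≈ _ σp≡c+1 _ = σp≡c+1
    ... | tri< σp≤c _ _ = ⊥-elim (constant-¬straddles clamp-const cut (clamp-≤ _ (ℕ.s≤s⁻¹ σp≤c))
                                                      (clamp-> p (ℕₚ.≤-reflexive (sym p≡c+1))))
    ... | tri> _ _ c+1<σp = ⊥-elim (constant-¬straddles′ shift-const cut (shift-≤ p (ℕₚ.≤-reflexive p≡c+1))
                                                         (shift-> _ c+1<σp))
    above : suc c ℕ.< toℕ p → suc c ℕ.< toℕ (σ ⟨$⟩ʳ p)
    above c+1<p with toℕ (σ ⟨$⟩ʳ p) ℕ.≤? suc c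
    ... | yes σp≤c+1 = ⊥-elim (constant-¬straddles shift-const cut (shift-≤ _ σp≤c+1) (shift-> p c+1<p))
    ... | no σp≰c+1 = ℕₚ.≰⇒> σp≰c+1

  respectsCuts⇒S[Π′] : ∀ σ → RespectsCuts σ → S[ Π′ ] σ
  respectsCuts⇒S[Π′] σ respects = S[]-intro Π′ σ λ y →
    Π′-block⇐ (σ ⟨$⟩ʳ y) y (same-Π̂-block (clamp-side y)) (same-Π̂-block (shift-side y))
    where
    same-Π̂-block : ∀ {u v} → (∀ c → Cut c → SameSideOf c (toℕ u) (toℕ v)) → Π̂ u ≡ Π̂ v
    same-Π̂-block {u} {v} sides = constantOn⇒Π̂-block u v (sameSide⇒constantOn _ _ (toℕ<n u) (toℕ<n v) sides)
    clamp-side : ∀ y c → Cut c → SameSideOf c (toℕ (clamp (σ ⟨$⟩ʳ y))) (toℕ (clamp y))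
    clamp-side y c cut = sameSide-trans (clamp-sameSide c<k (σ ⟨$⟩ʳ y))
      (sameSide-trans (respectsCuts-sameSide σ respects c cut y) (sameSide-sym (clamp-sameSide c<k y)))
      where c<k = ℕ.s≤s⁻¹ (proj₁ cut)
    shift-side : ∀ y c → Cut c → SameSideOf c (toℕ (shiftDown (σ ⟨$⟩ʳ y))) (toℕ (shiftDown y))
    shift-side y c cut =
        proj₂ (shiftDown-≤⇔ c y) ∘ proj₁ σ-side ∘ proj₁ (shiftDown-≤⇔ c (σ ⟨$⟩ʳ y))
      , proj₂ (shiftDown-≤⇔ c (σ ⟨$⟩ʳ y)) ∘ proj₂ σ-side ∘ proj₁ (shiftDown-≤⇔ c y)
      where σ-side = respectsCuts-sameSide-suc σ respects c cut y

  Π′-opposite : (∀ x → Π (opposite x) ≡ Π x) → ∀ x y → Π′ x ≡ Π′ y → Π′ (opposite x) ≡ Π′ (opposite y)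
  Π′-opposite Π-opposite x y same = Π′-block⇐ (opposite x) (opposite y)
    (subst₂ (λ u v → Π̂ u ≡ Π̂ v) (sym (clamp-opposite x)) (sym (clamp-opposite y)) (Π̂-opposite _ _ same-shift))
    (subst₂ (λ u v → Π̂ u ≡ Π̂ v) (sym (shiftDown-opposite x)) (sym (shiftDown-opposite y)) (Π̂-opposite _ _ same-clamp))
    where
    Π̂-opposite = coarsestIntervalRefinement-opposite Π̂-coarsest Π-opposite
    same-clamp = proj₁ (Π′-block⇒ x y same)
    same-shift = proj₂ (Π′-block⇒ x y same)

  Π′≋δ-part : (∀ x → Π (opposite x) ≡ Π x) → Π′ ≋ δ-part Π′
  Π′≋δ-part Π-opposite x y = Π′-opposite Π-opposite x y , λ same →
    subst₂ (λ u v → Π′ u ≡ Π′ v) (opposite-involutive x) (opposite-involutive y) (Π′-opposite Π-opposite _ _ same)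

  S[Π′]⊆Comp : ∀ τ → S[ Π′ ] τ → Comp (suc (suc k)) S[ Π ] τ
  S[Π′]⊆Comp τ τ∈S = deletionsPreserve⇒Comp Π τ (respectsCuts⇒deletionsPreserve τ (S[Π′]⇒respectsCuts τ τ∈S))

  Comp⇒S[Π′]⊎reversed : ∀ τ → Comp (suc (suc k)) S[ Π ] τ → S[ Π′ ] τ ⊎ S[ Π′ ] (τ ∘ₚ Perm.reverse)
  Comp⇒S[Π′]⊎reversed τ τ∈Comp = map (respectsCuts⇒S[Π′] τ) (respectsCuts⇒S[Π′] (τ ∘ₚ Perm.reverse))
    (deletionsPreserve⇒respectsCuts⊎reversed τ (Comp⇒deletionsPreserve Π τ τ∈Comp))

  Comp∧reversed-S[Π′]⇒δ∈S[Π] : ∀ τ → Comp (suc (suc k)) S[ Π ] τ → S[ Π′ ] (τ ∘ₚ Perm.reverse) → S[ Π ] (δ (suc k))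
  Comp∧reversed-S[Π′]⇒δ∈S[Π] τ τ∈Comp δτ∈S = S[]-intro Π Perm.reverse
    (opposite-invariant-from-deletions Π τ (τ ∘ₚ Perm.reverse) (λ _ → refl) (Comp⇒deletionsPreserve Π τ τ∈Comp)
      (respectsCuts⇒deletionsPreserve δτ (S[Π′]⇒respectsCuts δτ δτ∈S)))
    where δτ = τ ∘ₚ Perm.reverse

  δ·S[Π′]⊆Comp : S[ Π ] (δ (suc k)) → ∀ τ → (δ (suc (suc k)) · S[ Π′ ]) τ → Comp (suc (suc k)) S[ Π ] τ
  δ·S[Π′]⊆Comp δ∈S τ (σ , σ∈S , τ≗δσ) = deletionsPreserve⇒Comp Π τ
    (deletionsPreserve-opposite Π σ τ τ≗δσ (proj₁ δ∈S)
      (respectsCuts⇒deletionsPreserve σ (S[Π′]⇒respectsCuts σ σ∈S)))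

theorem4p7 : ∀ (k : ℕ) (Π : Partition (suc k)) (Π̂ : Partition (suc k)) (Π′ : Partition (suc (suc k)))
    → IsCoarsestIntervalRefinement Π Π̂
    → IsCoarsestCommonRefinement (hat¹ Π̂) (hatⁿ⁺¹ Π̂) Π′
    → (¬ S[ Π ] (δ (suc k)) → Comp (suc (suc k)) S[ Π ] ≐ S[ Π′ ])
      × (S[ Π ] (δ (suc k)) →
          (Comp (suc (suc k)) S[ Π ] ≐ (S[ Π′ ] ∪ (δ (suc (suc k)) · S[ Π′ ])))
          × ((S[ Π′ ] ∪ (δ (suc (suc k)) · S[ Π′ ])) ≐ Generated S[ Π′ ] (δ (suc (suc k))))
          × (Π′ ≋ δ-part Π′))
theorem4p7 k Π Π̂ Π′ Π̂-coarsest Π′-coarsest = case-δ∉S , case-δ∈S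
  where
  open Refinements Π̂-coarsest Π′-coarsest
  N = suc (suc k)

  case-δ∉S : ¬ S[ Π ] (δ (suc k)) → Comp N S[ Π ] ≐ S[ Π′ ]
  case-δ∉S δ∉S τ = (λ τ∈Comp → [ id , ⊥-elim ∘ δ∉S ∘ Comp∧reversed-S[Π′]⇒δ∈S[Π] τ τ∈Comp ]′
                                 (Comp⇒S[Π′]⊎reversed τ τ∈Comp))
                 , S[Π′]⊆Comp τ

  case-δ∈S : S[ Π ] (δ (suc k)) → (Comp N S[ Π ] ≐ (S[ Π′ ] ∪ (δ N · S[ Π′ ])))
                                × ((S[ Π′ ] ∪ (δ N · S[ Π′ ])) ≐ Generated S[ Π′ ] (δ N))
                                × (Π′ ≋ δ-part Π′)
  case-δ∈S δ∈S = (λ τ → map₂ (∘reverse⇒coset S[ Π′ ] τ) ∘ Comp⇒S[Π′]⊎reversed τ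
                      , [ S[Π′]⊆Comp τ , δ·S[Π′]⊆Comp δ∈S τ ]′)
               , (λ τ → ∪coset⇒generated Π′ Π′-sym , generated⇒∪coset Π′ Π′-sym)
               , Π′≋δ-part (proj₁ δ∈S)
    where Π′-sym = Π′-opposite (proj₁ δ∈S)
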